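{- Let $q \ge 1$ and let $G$ be a finite simple graph with maximum degree at most $q$ whose edges are colored (not necessarily properly) with finitely many colors such that every color class contains at least $4eq$ edges. Then $G$ contains a rainbow matching which uses every color.
   Context: A color class is the set of edges of a given color. A matching is a set of pairwise vertex-disjoint edges; it is rainbow if its edges have pairwise distinct colors. "Uses every color" means it contains exactly one edge of each color. Here $e$ is Euler's number. -}

module Defs where

open import Data.Nat using (ℕ; zero; suc; _+_; _*_; _≤_; _!)
open import Data.Fin using (Fin; zero; suc; _≟_)
open import Data.Bool using (Bool; true; false; _∨_; if_then_else_)
open import Data.Product using (_×_; proj₁; proj₂; swap)
open import Data.Sum using (_⊎_)
open import Data.Empty using (⊥)
open import Relation.Nullary using (¬_)
open import Relation.Nullary.Decidable using (isYes)
open import Relation.Binary.PropositionalEquality using (_≡_)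

-- An (undirected) edge on vertex set Fin n, given by its two endpoints.
Edge : ℕ → Set
Edge n = Fin n × Fin n

countFin : {m : ℕ} → (Fin m → Bool) → ℕ
countFin {zero}  P = 0
countFin {suc m} P = (if P zero then 1 else 0) + countFin (λ j → P (suc j))

Loopless : {n m : ℕ} → (Fin m → Edge n) → Set
Loopless E = ∀ j → ¬ (proj₁ (E j) ≡ proj₂ (E j))

SameEdge : {n : ℕ} → Edge n → Edge n → Set
SameEdge e f = (e ≡ f) ⊎ (swap e ≡ f)

NoParallel : {n m : ℕ} → (Fin m → Edge n) → Set
NoParallel E = ∀ j k → SameEdge (E j) (E k) → j ≡ k

deg : {n m : ℕ} → (Fin m → Edge n) → Fin n → ℕ
deg E v = countFin (λ j → isYes (v ≟ proj₁ (E j)) ∨ isYes (v ≟ proj₂ (E j)))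

classSize : {m c : ℕ} → (Fin m → Fin c) → Fin c → ℕ
classSize χ i = countFin (λ j → isYes (χ j ≟ i))

Incident : {n : ℕ} → Fin n → Edge n → Set
Incident v e = (v ≡ proj₁ e) ⊎ (v ≡ proj₂ e)

Disjoint : {n : ℕ} → Edge n → Edge n → Set
Disjoint e f = ∀ v → Incident v e → Incident v f → ⊥

-- eScaled K = K! * Σ_{k=0}^{K} 1/k!  (an integer), so that
-- e = sup_K eScaled K / K!.
eScaled : ℕ → ℕ
eScaled zero    = 1
eScaled (suc K) = suc K * eScaled K + 1

-- "N ≥ 4·e·q" for a natural number N: N/(4q) ≥ every partial sum of
-- Σ 1/k!, i.e. N/(4q) ≥ e.
AtLeast4eq : ℕ → ℕ → Set
AtLeast4eq q N = ∀ K → 4 * q * eScaled K ≤ N * (K !)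

module Submission where

-- Colours are added one at a time by an augmenting argument in the style of Haxell. Given a
-- rainbow matching f on a set A of colours and a new colour t, grow a chain of links
-- (y , γ): y has colour t or the colour of an older link, is disjoint from the older link edges
-- and their matching edges, and meets the matching edge f γ. The k links and their matching
-- edges meet at most 4qk edges, while the k + 1 usable colours carry at least 4q(k + 1)
-- edges, so there is always a further admissible edge y. If y meets no matching edge, it
-- completes the matching (colour t) or takes over the colour of a link, which is cut off
-- together with everything newer; the edge of that link has lost a blocker and is settled in
-- turn. The numbers of blockers along the chain, read from the oldest link, decrease
-- lexicographically at every step.

open import Defs
open import Data.Bool using (Bool; true; false; _∨_; _∧_)
open import Data.Bool.Properties
  using (∨-conicalˡ; ∨-conicalʳ; ∧-conicalˡ; ∧-conicalʳ; ∨-zeroʳ; ∧-zeroʳ; ¬-not)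
  renaming (_≟_ to _≟ᵇ_)
open import Data.Fin using (Fin; zero; suc; _≟_; toℕ; fromℕ<)
open import Data.Fin.Properties using (any?; toℕ-fromℕ<; toℕ-injective; toℕ<n)
open import Data.List using (List; []; _∷_; _++_; [_]; _∷ʳ_; length; map; reverse)
open import Data.List.Properties using (unfold-reverse; length-reverse; length-++; length-map; ++-assoc)
open import Data.List.Relation.Binary.Pointwise using (Pointwise; []; _∷_; reverse⁺)
  renaming (refl to Pointwise-refl)
open import Data.List.Relation.Unary.All using (All; []; _∷_)
open import Data.Nat using (ℕ; zero; suc; _+_; _*_; _^_; _≤_; _<_; _<?_; z≤n; s≤s; s≤s⁻¹; >-nonZero)
open import Data.Nat.Properties hiding (_≟_)
open import Data.Nat.Induction using (<-wellFounded)
open import Data.Product using (Σ; Σ-syntax; _×_; _,_; proj₁; proj₂)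
import Data.Product as Product
open import Data.Sum using (_⊎_; inj₁; inj₂)
import Data.Sum as Sum
open import Data.Vec.Functional using (updateAt)
open import Data.Vec.Functional.Properties using (updateAt-updates; updateAt-minimal)
open import Function using (_∘_; const)
open import Induction.WellFounded using (Acc; acc)
open import Relation.Nullary using (¬_; Dec; yes; no; contradiction)
open import Relation.Nullary.Decidable using (isYes)
open import Relation.Binary.PropositionalEquality
  using (_≡_; _≢_; refl; sym; trans; cong; cong₂; subst; subst₂; module ≡-Reasoning)

module _ {p} {P : Set p} where

  isYes-true : (d : Dec P) → P → isYes d ≡ true
  isYes-true (yes _) _  = refl
  isYes-true (no ¬p) p = contradiction p ¬p

  isYes-false : (d : Dec P) → ¬ P → isYes d ≡ false
  isYes-false (yes p) ¬p = contradiction p ¬p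
  isYes-false (no _)  _  = refl

  isYes-true⁻¹ : (d : Dec P) → isYes d ≡ true → P
  isYes-true⁻¹ (yes p) _ = p
  isYes-true⁻¹ (no _) ()

∨-true⁻¹ : ∀ a {b} → a ∨ b ≡ true → a ≡ true ⊎ b ≡ true
∨-true⁻¹ true  _ = inj₁ refl
∨-true⁻¹ false e = inj₂ e

count-≤ : ∀ {m} (P : Fin m → Bool) → countFin P ≤ m
count-≤ {zero}  P = z≤n
count-≤ {suc m} P with P zero
... | true  = s≤s (count-≤ (P ∘ suc))
... | false = m≤n⇒m≤1+n (count-≤ (P ∘ suc))

count-false : ∀ {m} (P : Fin m → Bool) → (∀ j → P j ≡ false) → countFin P ≡ 0
count-false {zero}  P h = refl
count-false {suc m} P h rewrite h zero = count-false (P ∘ suc) (h ∘ suc)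

count-pos : ∀ {m} (P : Fin m → Bool) (j : Fin m) → P j ≡ true → 0 < countFin P
count-pos P zero    e rewrite e = s≤s z≤n
count-pos P (suc j) e = ≤-trans (count-pos (P ∘ suc) j e) (m≤n+m _ _)

count-mono : ∀ {m} (P Q : Fin m → Bool) → (∀ j → P j ≡ true → Q j ≡ true) →
  countFin P ≤ countFin Q
count-mono {zero}  P Q h = z≤n
count-mono {suc m} P Q h with P zero in eP | Q zero in eQ
... | true  | true  = s≤s (count-mono (P ∘ suc) (Q ∘ suc) (h ∘ suc))
... | true  | false with () ← trans (sym (h zero eP)) eQ
... | false | true  = m≤n⇒m≤1+n (count-mono (P ∘ suc) (Q ∘ suc) (h ∘ suc))
... | false | false = count-mono (P ∘ suc) (Q ∘ suc) (h ∘ suc)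

count-strict-mono : ∀ {m} (P Q : Fin m → Bool) → (∀ j → P j ≡ true → Q j ≡ true) →
  (j₀ : Fin m) → P j₀ ≡ false → Q j₀ ≡ true → countFin P < countFin Q
count-strict-mono P Q h zero e₁ e₂ rewrite e₁ | e₂ = s≤s (count-mono (P ∘ suc) (Q ∘ suc) (h ∘ suc))
count-strict-mono P Q h (suc j₀) e₁ e₂ with P zero in eP | Q zero in eQ
... | true  | true  = s≤s (count-strict-mono (P ∘ suc) (Q ∘ suc) (h ∘ suc) j₀ e₁ e₂)
... | true  | false with () ← trans (sym (h zero eP)) eQ
... | false | true  = m≤n⇒m≤1+n (count-strict-mono (P ∘ suc) (Q ∘ suc) (h ∘ suc) j₀ e₁ e₂)
... | false | false = count-strict-mono (P ∘ suc) (Q ∘ suc) (h ∘ suc) j₀ e₁ e₂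

count-∨-≤ : ∀ {m} (P Q : Fin m → Bool) → countFin (λ j → P j ∨ Q j) ≤ countFin P + countFin Q
count-∨-≤ {zero}  P Q = z≤n
count-∨-≤ {suc m} P Q with P zero | Q zero
... | true  | true  = s≤s (≤-trans (count-∨-≤ (P ∘ suc) (Q ∘ suc))
                                   (≤-trans (n≤1+n _) (≤-reflexive (sym (+-suc _ _)))))
... | true  | false = s≤s (count-∨-≤ (P ∘ suc) (Q ∘ suc))
... | false | true  = ≤-trans (s≤s (count-∨-≤ (P ∘ suc) (Q ∘ suc))) (≤-reflexive (sym (+-suc _ _)))
... | false | false = count-∨-≤ (P ∘ suc) (Q ∘ suc)

count-∨-disjoint : ∀ {m} (P Q : Fin m → Bool) → (∀ j → P j ≡ true → Q j ≡ false) →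
  countFin (λ j → P j ∨ Q j) ≡ countFin P + countFin Q
count-∨-disjoint {zero}  P Q h = refl
count-∨-disjoint {suc m} P Q h with P zero in eP | Q zero in eQ
... | true  | true  with () ← trans (sym (h zero eP)) eQ
... | true  | false = cong suc (count-∨-disjoint (P ∘ suc) (Q ∘ suc) (h ∘ suc))
... | false | true  = trans (cong suc (count-∨-disjoint (P ∘ suc) (Q ∘ suc) (h ∘ suc))) (sym (+-suc _ _))
... | false | false = count-∨-disjoint (P ∘ suc) (Q ∘ suc) (h ∘ suc)

count-<-witness : ∀ {m} (P Q : Fin m → Bool) → countFin Q < countFin P →
  Σ[ j ∈ Fin m ] P j ≡ true × Q j ≡ false
count-<-witness {suc m} P Q h with P zero in eP | Q zero in eQ | count-<-witness (P ∘ suc) (Q ∘ suc)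
... | true  | false | _ = zero , eP , eQ
... | true  | true  | later with j , w ← later (s≤s⁻¹ h) = suc j , w
... | false | true  | later with j , w ← later (<-trans (n<1+n _) h) = suc j , w
... | false | false | later with j , w ← later h = suc j , w

isYes-≟-sym : ∀ {k} (x y : Fin k) → isYes (x ≟ y) ≡ isYes (y ≟ x)
isYes-≟-sym x y with x ≟ y
... | yes x≡y = sym (isYes-true (y ≟ x) (sym x≡y))
... | no  x≢y = sym (isYes-false (y ≟ x) (x≢y ∘ sym))

∨-interchange : (a b c d : Bool) → (a ∨ b) ∨ (c ∨ d) ≡ (a ∨ c) ∨ (b ∨ d)
∨-interchange true  b     c     d = refl
∨-interchange false true  true  d = refl
∨-interchange false true  false d = refl
∨-interchange false false c     d = refl

module _ {n m : ℕ} (E : Fin m → Edge n) where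

  meets : Fin n → Fin m → Bool
  meets v j = isYes (v ≟ proj₁ (E j)) ∨ isYes (v ≟ proj₂ (E j))

  touches : Fin m → Fin m → Bool
  touches e j = meets (proj₁ (E e)) j ∨ meets (proj₂ (E e)) j

  touches-sym : ∀ e j → touches e j ≡ touches j e
  touches-sym e j
    rewrite isYes-≟-sym (proj₁ (E j)) (proj₁ (E e)) | isYes-≟-sym (proj₁ (E j)) (proj₂ (E e))
          | isYes-≟-sym (proj₂ (E j)) (proj₁ (E e)) | isYes-≟-sym (proj₂ (E j)) (proj₂ (E e))
    = ∨-interchange (isYes (proj₁ (E e) ≟ proj₁ (E j))) (isYes (proj₁ (E e) ≟ proj₂ (E j)))
                    (isYes (proj₂ (E e) ≟ proj₁ (E j))) (isYes (proj₂ (E e) ≟ proj₂ (E j)))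

  incident⇒meets : ∀ {v j} → Incident v (E j) → meets v j ≡ true
  incident⇒meets {v} {j} (inj₁ p) = cong (_∨ isYes (v ≟ proj₂ (E j))) (isYes-true (v ≟ proj₁ (E j)) p)
  incident⇒meets {v} {j} (inj₂ p) =
    trans (cong (isYes (v ≟ proj₁ (E j)) ∨_) (isYes-true (v ≟ proj₂ (E j)) p)) (∨-zeroʳ _)

  common-vertex⇒touches : ∀ {v e j} → Incident v (E e) → Incident v (E j) → touches e j ≡ true
  common-vertex⇒touches {e = e} {j} (inj₁ refl) i = cong (_∨ meets (proj₂ (E e)) j) (incident⇒meets i)
  common-vertex⇒touches {e = e} {j} (inj₂ refl) i =
    trans (cong (meets (proj₁ (E e)) j ∨_) (incident⇒meets i)) (∨-zeroʳ _)

  ¬touches⇒Disjoint : ∀ e j → touches e j ≡ false → Disjoint (E e) (E j)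
  ¬touches⇒Disjoint e j h v iₑ iⱼ with () ← trans (sym h) (common-vertex⇒touches {v} {e} {j} iₑ iⱼ)

  count-touches-≤ : ∀ {q} → (∀ v → deg E v ≤ q) → ∀ e → countFin (touches e) ≤ 2 * q
  count-touches-≤ {q} deg≤q e = begin
    countFin (touches e)
      ≤⟨ count-∨-≤ (meets (proj₁ (E e))) (meets (proj₂ (E e))) ⟩
    countFin (meets (proj₁ (E e))) + countFin (meets (proj₂ (E e)))
      ≤⟨ +-mono-≤ (deg≤q (proj₁ (E e))) (deg≤q (proj₂ (E e))) ⟩
    q + q
      ≡⟨ cong (q +_) (+-identityʳ q) ⟨
    2 * q ∎
    where open ≤-Reasoning

-- val L ds is the L-digit base-(suc b) numeral with leading digits ds, plus
-- (suc b) ^ (L - length ds): the unwritten tail counts as one more unit in the last written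
-- place.  So appending a digit below b lowers the value, and lists of length at most L
-- compare lexicographically, a proper prefix above its extensions (longer lists get junk 0).
module Positional (b : ℕ) where

  val : ℕ → List ℕ → ℕ
  val L       []       = suc b ^ L
  val zero    (_ ∷ _)  = 0
  val (suc L) (d ∷ ds) = d * suc b ^ L + val L ds

  val-pos : ∀ L ds → length ds ≤ L → 0 < val L ds
  val-pos L       []       _       = m^n>0 (suc b) L
  val-pos (suc L) (d ∷ ds) (s≤s h) = ≤-trans (val-pos L ds h) (m≤n+m _ _)

  val-∷ʳ-< : ∀ L ds d → length ds < L → suc d < suc b → val L (ds ∷ʳ d) < val L ds
  val-∷ʳ-< (suc L) []       d _       d<b = begin-strict
    d * suc b ^ L + suc b ^ L ≡⟨ +-comm (d * suc b ^ L) (suc b ^ L) ⟩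
    suc d * suc b ^ L         <⟨ *-monoˡ-< (suc b ^ L) {{>-nonZero (m^n>0 (suc b) L)}} d<b ⟩
    suc b * suc b ^ L         ∎
    where open ≤-Reasoning
  val-∷ʳ-< (suc L) (x ∷ ds) d (s≤s h) d<b = +-monoʳ-< (x * suc b ^ L) (val-∷ʳ-< L ds d h d<b)

  val-lex : ∀ L {xs′ xs d′ d} ys → Pointwise _≤_ xs′ xs → d′ < d → length (xs ++ d ∷ ys) ≤ L →
    val L (xs′ ∷ʳ d′) < val L (xs ++ d ∷ ys)
  val-lex (suc L) {d′ = d′} {d} ys [] d′<d (s≤s h) = begin-strict
    d′ * suc b ^ L + suc b ^ L ≡⟨ +-comm (d′ * suc b ^ L) (suc b ^ L) ⟩
    suc d′ * suc b ^ L         ≤⟨ *-monoˡ-≤ (suc b ^ L) d′<d ⟩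
    d * suc b ^ L              <⟨ m<m+n (d * suc b ^ L) (val-pos L ys h) ⟩
    d * suc b ^ L + val L ys   ∎
    where open ≤-Reasoning
  val-lex (suc L) ys (x′≤x ∷ xs′≤xs) d′<d (s≤s h) =
    +-mono-≤-< (*-monoˡ-≤ (suc b ^ L) x′≤x) (val-lex L ys xs′≤xs d′<d h)

  val-reverse-∷-< : ∀ L ds d → length ds < L → suc d < suc b →
    val L (reverse (d ∷ ds)) < val L (reverse ds)
  val-reverse-∷-< L ds d h d<b rewrite unfold-reverse d ds =
    val-∷ʳ-< L (reverse ds) d (subst (_< L) (sym (length-reverse ds)) h) d<b

  val-reverse-lex : ∀ L {xs′ xs d′ d} e → Pointwise _≤_ xs′ xs → d′ < d → length (e ∷ d ∷ xs) ≤ L →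
    val L (reverse (d′ ∷ xs′)) < val L (reverse (e ∷ d ∷ xs))
  val-reverse-lex L {xs′} {xs} {d′} {d} e xs′≤xs d′<d h
    rewrite unfold-reverse d′ xs′ | unfold-reverse e (d ∷ xs) | unfold-reverse d xs
          | ++-assoc (reverse xs) [ d ] [ e ]
    = val-lex L [ e ] (reverse⁺ xs′≤xs) d′<d (subst (_≤ L) (sym length-eq) h)
    where
      length-eq : length (reverse xs ++ d ∷ [ e ]) ≡ length (e ∷ d ∷ xs)
      length-eq = begin
        length (reverse xs ++ d ∷ [ e ]) ≡⟨ length-++ (reverse xs) ⟩
        length (reverse xs) + 2          ≡⟨ cong (_+ 2) (length-reverse xs) ⟩
        length xs + 2                    ≡⟨ +-comm (length xs) 2 ⟩
        length (e ∷ d ∷ xs)              ∎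
        where open ≡-Reasoning

coloursBelow : ∀ {c} → ℕ → Fin c → Bool
coloursBelow k i = isYes (toℕ i <? k)

module Rainbow {n m c : ℕ} (E : Fin m → Edge n) (χ : Fin m → Fin c) where

  record RainbowOn (A : Fin c → Bool) (f : Fin c → Fin m) : Set where
    field
      coloured : ∀ i → A i ≡ true → χ (f i) ≡ i
      disjoint : ∀ i j → A i ≡ true → A j ≡ true → i ≢ j → touches E (f i) (f j) ≡ false

  open RainbowOn

  rainbow-⊆ : ∀ {A A′ f} → (∀ i → A′ i ≡ true → A i ≡ true) → RainbowOn A f → RainbowOn A′ f
  rainbow-⊆ A′⊆A R = record
    { coloured = λ i a → coloured R i (A′⊆A i a)
    ; disjoint = λ i j a b → disjoint R i j (A′⊆A i a) (A′⊆A j b)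
    }

  rainbow-reassign : ∀ {A A′ f g z} → RainbowOn A f → χ z ≡ g →
    (∀ γ → A γ ≡ true → touches E z (f γ) ≡ false) →
    (∀ i → A′ i ≡ true → i ≢ g → A i ≡ true) →
    RainbowOn A′ (updateAt f g (const z))
  rainbow-reassign {A} {A′} {f} {g} {z} R χz≡g z-free A′⊆A+g =
    record { coloured = col ; disjoint = dis }
    where
      f′ : Fin c → Fin m
      f′ = updateAt f g (const z)

      col : ∀ i → A′ i ≡ true → χ (f′ i) ≡ i
      col i a with i ≟ g
      ... | yes refl rewrite updateAt-updates i {const z} f = χz≡g
      ... | no  i≢g  rewrite updateAt-minimal i g {const z} f i≢g = coloured R i (A′⊆A+g i a i≢g)

      dis : ∀ i j → A′ i ≡ true → A′ j ≡ true → i ≢ j → touches E (f′ i) (f′ j) ≡ false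
      dis i j a b i≢j with i ≟ g | j ≟ g
      ... | yes refl | yes refl = contradiction refl i≢j
      ... | yes refl | no j≢g
        rewrite updateAt-updates i {const z} f | updateAt-minimal j i {const z} f j≢g
        = z-free j (A′⊆A+g j b j≢g)
      ... | no i≢g | yes refl
        rewrite updateAt-updates j {const z} f | updateAt-minimal i j {const z} f i≢g
        = trans (touches-sym E (f i) z) (z-free i (A′⊆A+g i a i≢g))
      ... | no i≢g | no j≢g
        rewrite updateAt-minimal i g {const z} f i≢g | updateAt-minimal j g {const z} f j≢g
        = disjoint R i j (A′⊆A+g i a i≢g) (A′⊆A+g j b j≢g) i≢j

  module Bounded {q : ℕ} (1≤q : 1 ≤ q) (deg≤q : ∀ v → deg E v ≤ q)
                 (4q≤class : ∀ i → 4 * q ≤ classSize χ i) where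

    1≤4q : 1 ≤ 4 * q
    1≤4q = ≤-trans 1≤q (m≤m+n q (3 * q))

    module Augmentation (A : Fin c → Bool) (t : Fin c) (At≡false : A t ≡ false) where

      -- Chains are listed newest link first; a link (y , γ) records that y is blocked by f γ.
      Link : Set
      Link = Fin m × Fin c

      palette : List Link → Fin c → Bool
      palette []             i = isYes (i ≟ t)
      palette ((_ , γ) ∷ ls) i = isYes (i ≟ γ) ∨ palette ls i

      crowded : (Fin c → Fin m) → List Link → Fin m → Bool
      crowded f []             j = false
      crowded f ((y , γ) ∷ ls) j = (touches E y j ∨ touches E (f γ) j) ∨ crowded f ls j

      blocks : (Fin c → Fin m) → Fin m → Fin c → Bool
      blocks f y γ = A γ ∧ touches E y (f γ)

      blockers : (Fin c → Fin m) → Fin m → ℕ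
      blockers f y = countFin (blocks f y)

      digits : (Fin c → Fin m) → List Link → List ℕ
      digits f = map (blockers f ∘ proj₁)

      Admissible : (Fin c → Fin m) → List Link → Fin m → Set
      Admissible f ls y = palette ls (χ y) ≡ true × crowded f ls y ≡ false

      data Chain (f : Fin c → Fin m) : List Link → Set where
        []   : Chain f []
        link : ∀ {y γ ls} → blocks f y γ ≡ true → Admissible f ls y → Chain f ls → Chain f ((y , γ) ∷ ls)

      Avoids : Fin c → List Link → Set
      Avoids g = All (λ l → proj₂ l ≢ g)

      matched≢t : ∀ {γ} → A γ ≡ true → γ ≢ t
      matched≢t Aγ refl with () ← trans (sym Aγ) At≡false

      crowded-∷⁻ : ∀ {f y γ ls j} → crowded f ((y , γ) ∷ ls) j ≡ false →
        touches E y j ≡ false × touches E (f γ) j ≡ false × crowded f ls j ≡ false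
      crowded-∷⁻ {f} {y} {γ} {ls} {j} cr =
        ∨-conicalˡ (touches E y j) (touches E (f γ) j) near ,
        ∨-conicalʳ (touches E y j) (touches E (f γ) j) near ,
        ∨-conicalʳ (touches E y j ∨ touches E (f γ) j) (crowded f ls j) cr
        where
          near : touches E y j ∨ touches E (f γ) j ≡ false
          near = ∨-conicalˡ (touches E y j ∨ touches E (f γ) j) (crowded f ls j) cr

      crowded-avoids : ∀ {f y g} ls → crowded f ls y ≡ false → touches E y (f g) ≡ true → Avoids g ls
      crowded-avoids []                       _  _   = []
      crowded-avoids {f} {y} {g} ((y′ , γ′) ∷ ls) cr hit
        with _ , untouched , far ← crowded-∷⁻ {f} {y′} {γ′} {ls} cr
        = γ′≢g ∷ crowded-avoids ls far hit
        where
          γ′≢g : γ′ ≢ g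
          γ′≢g refl with () ← trans (sym (trans (touches-sym E y (f γ′)) untouched)) hit

      palette-false : ∀ {g} ls → g ≢ t → Avoids g ls → palette ls g ≡ false
      palette-false {g} []             g≢t []         = isYes-false (g ≟ t) g≢t
      palette-false {g} ((_ , γ) ∷ ls) g≢t (γ≢g ∷ av) =
        trans (cong (_∨ palette ls g) (isYes-false (g ≟ γ) (γ≢g ∘ sym))) (palette-false ls g≢t av)

      palette-count : ∀ {f ls} → Chain f ls → suc (length ls) * (4 * q) ≤ countFin (palette ls ∘ χ)
      palette-count [] = ≤-trans (≤-reflexive (+-identityʳ (4 * q))) (4q≤class t)
      palette-count {f} {(y , γ) ∷ ls} (link b (_ , cr) C) = begin
        4 * q + suc (length ls) * (4 * q)
          ≤⟨ +-mono-≤ (4q≤class γ) (palette-count C) ⟩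
        classSize χ γ + countFin (palette ls ∘ χ)
          ≡⟨ count-∨-disjoint (λ j → isYes (χ j ≟ γ)) (palette ls ∘ χ) fresh ⟨
        countFin (palette ((y , γ) ∷ ls) ∘ χ) ∎
        where
          open ≤-Reasoning
          fresh : ∀ j → isYes (χ j ≟ γ) ≡ true → palette ls (χ j) ≡ false
          fresh j e rewrite isYes-true⁻¹ (χ j ≟ γ) e =
            palette-false ls (matched≢t (∧-conicalˡ _ _ b)) (crowded-avoids ls cr (∧-conicalʳ _ _ b))

      crowded-count : ∀ f ls → countFin (crowded f ls) ≤ length ls * (4 * q)
      crowded-count f []             = ≤-reflexive (count-false (crowded f []) (λ _ → refl))
      crowded-count f ((y , γ) ∷ ls) = begin
        countFin (crowded f ((y , γ) ∷ ls))
          ≤⟨ count-∨-≤ (λ j → touches E y j ∨ touches E (f γ) j) (crowded f ls) ⟩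
        countFin (λ j → touches E y j ∨ touches E (f γ) j) + countFin (crowded f ls)
          ≤⟨ +-mono-≤ (count-∨-≤ (touches E y) (touches E (f γ))) (crowded-count f ls) ⟩
        (countFin (touches E y) + countFin (touches E (f γ))) + length ls * (4 * q)
          ≤⟨ +-monoˡ-≤ _ (+-mono-≤ (count-touches-≤ E deg≤q y) (count-touches-≤ E deg≤q (f γ))) ⟩
        (2 * q + 2 * q) + length ls * (4 * q)
          ≡⟨ cong (_+ length ls * (4 * q)) (*-distribʳ-+ q 2 2) ⟨
        suc (length ls) * (4 * q) ∎
        where open ≤-Reasoning

      admissible-exists : ∀ {f ls} → Chain f ls → Σ[ y ∈ Fin m ] Admissible f ls y
      admissible-exists {f} {ls} C = count-<-witness (palette ls ∘ χ) (crowded f ls) (begin-strict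
        countFin (crowded f ls)       ≤⟨ crowded-count f ls ⟩
        length ls * (4 * q)           <⟨ m<n+m (length ls * (4 * q)) 1≤4q ⟩
        suc (length ls) * (4 * q)     ≤⟨ palette-count C ⟩
        countFin (palette ls ∘ χ)     ∎)
        where open ≤-Reasoning

      digits-length : ∀ {f ls} → Chain f ls → length (digits f ls) < m
      digits-length {f} {ls} C = begin
        suc (length (digits f ls))    ≡⟨ cong suc (length-map (blockers f ∘ proj₁) ls) ⟩
        suc (length ls)               ≡⟨ *-identityʳ (suc (length ls)) ⟨
        suc (length ls) * 1           ≤⟨ *-monoʳ-≤ (suc (length ls)) 1≤4q ⟩
        suc (length ls) * (4 * q)     ≤⟨ palette-count C ⟩
        countFin (palette ls ∘ χ)     ≤⟨ count-≤ (palette ls ∘ χ) ⟩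
        m                             ∎
        where open ≤-Reasoning

      module _ (f : Fin c → Fin m) (g : Fin c) (z : Fin m) where

        private
          f′ : Fin c → Fin m
          f′ = updateAt f g (const z)

        blocks-reassign-≢ : ∀ {y γ} → γ ≢ g → blocks f′ y γ ≡ blocks f y γ
        blocks-reassign-≢ {y} {γ} γ≢g = cong (λ e → A γ ∧ touches E y e) (updateAt-minimal γ g f γ≢g)

        crowded-reassign : ∀ {ls} → Avoids g ls → ∀ j → crowded f′ ls j ≡ crowded f ls j
        crowded-reassign []                         j = refl
        crowded-reassign {(y , γ) ∷ _} (γ≢g ∷ av) j =
          cong₂ (λ e rest → (touches E y j ∨ touches E e j) ∨ rest)
                (updateAt-minimal γ g f γ≢g) (crowded-reassign av j)

        chain-reassign : ∀ {ls} → Avoids g ls → Chain f ls → Chain f′ ls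
        chain-reassign []         []                    = []
        chain-reassign (γ≢g ∷ av) (link {y} b (p , cr) C) =
          link (trans (blocks-reassign-≢ γ≢g) b) (p , trans (crowded-reassign av y) cr)
               (chain-reassign av C)

        blocks-reassign : ∀ {y} → touches E y z ≡ false → ∀ γ → blocks f′ y γ ≡ true → blocks f y γ ≡ true
        blocks-reassign {y} y∤z γ b with γ ≟ g
        ... | no γ≢g = trans (sym (blocks-reassign-≢ γ≢g)) b
        ... | yes refl
          with () ← trans (sym y∤z)
                          (subst (λ e → touches E y e ≡ true) (updateAt-updates γ f) (∧-conicalʳ _ _ b))

        blockers-reassign-≤ : ∀ {y} → touches E y z ≡ false → blockers f′ y ≤ blockers f y
        blockers-reassign-≤ {y} y∤z = count-mono (blocks f′ y) (blocks f y) (blocks-reassign y∤z)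

        blockers-reassign-< : ∀ {y} → touches E y z ≡ false → blocks f y g ≡ true →
          blockers f′ y < blockers f y
        blockers-reassign-< {y} y∤z b =
          count-strict-mono (blocks f′ y) (blocks f y) (blocks-reassign y∤z) g unblocked b
          where
            unblocked : blocks f′ y g ≡ false
            unblocked = begin
              A g ∧ touches E y (f′ g) ≡⟨ cong (λ e → A g ∧ touches E y e) (updateAt-updates g f) ⟩
              A g ∧ touches E y z      ≡⟨ cong (A g ∧_) y∤z ⟩
              A g ∧ false              ≡⟨ ∧-zeroʳ (A g) ⟩
              false                    ∎
              where open ≡-Reasoning

        digits-reassign : ∀ ls → crowded f ls z ≡ false → Pointwise _≤_ (digits f′ ls) (digits f ls)
        digits-reassign []             _  = []
        digits-reassign ((y , γ) ∷ ls) cr with y∤z , _ , far ← crowded-∷⁻ {f} {y} {γ} {ls} cr =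
          blockers-reassign-≤ y∤z ∷ digits-reassign ls far

      open Positional (suc c)

      record State : Set where
        constructor state
        field
          matching : Fin c → Fin m
          links    : List Link
          rainbow  : RainbowOn A matching
          chain    : Chain matching links

      potential : State → ℕ
      potential (state f ls _ _) = val m (reverse (digits f ls))

      A⁺ : Fin c → Bool
      A⁺ i = A i ∨ isYes (i ≟ t)

      A⁺⊆A+t : ∀ i → A⁺ i ≡ true → i ≢ t → A i ≡ true
      A⁺⊆A+t i e i≢t with ∨-true⁻¹ (A i) e
      ... | inj₁ Ai  = Ai
      ... | inj₂ i≡t = contradiction (isYes-true⁻¹ (i ≟ t) i≡t) i≢t

      Augmented : Set
      Augmented = Σ (Fin c → Fin m) (RainbowOn A⁺)

      Outcome : ℕ → Set
      Outcome bound = Augmented ⊎ Σ[ s ∈ State ] potential s ≤ bound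

      relax : ∀ {b b′} → b ≤ b′ → Outcome b → Outcome b′
      relax b≤b′ = Sum.map₂ (Product.map₂ (λ p → ≤-trans p b≤b′))

      Unblocked : (Fin c → Fin m) → Fin m → Set
      Unblocked f y = ∀ γ → blocks f y γ ≡ false

      unblocked-touches : ∀ {f y} → Unblocked f y → ∀ γ → A γ ≡ true → touches E y (f γ) ≡ false
      unblocked-touches {f} {y} free γ Aγ = subst (λ a → a ∧ touches E y (f γ) ≡ false) Aγ (free γ)

      settle : ∀ f ls y → RainbowOn A f → Chain f ls → Admissible f ls y →
        Outcome (val m (reverse (blockers f y ∷ digits f ls)))
      settle-unblocked : ∀ f ls y → RainbowOn A f → Chain f ls → Admissible f ls y → Unblocked f y →
        Outcome (val m (reverse (blockers f y ∷ digits f ls)))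

      settle f ls y R C adm with any? (λ γ → blocks f y γ ≟ᵇ true)
      ... | yes (γ , b) = inj₂ (state f ((y , γ) ∷ ls) R (link b adm C) , ≤-refl)
      ... | no ∄γ       = settle-unblocked f ls y R C adm (λ γ → ¬-not (λ b → ∄γ (γ , b)))

      settle-unblocked f [] y R [] (χy∈ , _) free =
        inj₁ (updateAt f t (const y) ,
              rainbow-reassign R (isYes-true⁻¹ (χ y ≟ t) χy∈) (unblocked-touches free) A⁺⊆A+t)
      settle-unblocked f ((y′ , γ′) ∷ ls) y R C@(link b (χy′∈ , cr′) C′) (χy∈ , cr) free
        with crowded-∷⁻ {f} {y′} {γ′} {ls} cr | ∨-true⁻¹ (isYes (χ y ≟ γ′)) χy∈
      ... | _ , _ , far | inj₂ χy∈older =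
        relax (<⇒≤ (val-reverse-lex m (blockers f y) (Pointwise-refl ≤-refl {digits f ls})
                                    y-below-y′ (digits-length C)))
              (settle-unblocked f ls y R C′ (χy∈older , far) free)
        where
          y-below-y′ : blockers f y < blockers f y′
          y-below-y′ = subst (_< blockers f y′) (sym (count-false (blocks f y) free))
                             (count-pos (blocks f y′) γ′ b)
      -- y takes over colour γ′: the link edge y′ loses its blocker γ′, and no older link edge
      -- gains one, since y is disjoint from all of them.
      ... | y′∤y , _ , far | inj₁ χy≡γ′ =
        relax (<⇒≤ (val-reverse-lex m (blockers f y) (digits-reassign f γ′ y ls far)
                                    (blockers-reassign-< f γ′ y y′∤y b) (digits-length C)))
              (settle (updateAt f γ′ (const y)) ls y′ R′ (chain-reassign f γ′ y avoids C′)
                      (χy′∈ , trans (crowded-reassign f γ′ y avoids y′) cr′))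
        where
          avoids : Avoids γ′ ls
          avoids = crowded-avoids ls cr′ (∧-conicalʳ _ _ b)
          R′ : RainbowOn A (updateAt f γ′ (const y))
          R′ = rainbow-reassign R (isYes-true⁻¹ (χ y ≟ γ′) χy≡γ′) (unblocked-touches free) (λ i Ai _ → Ai)

      grow : (s : State) → Acc _<_ (potential s) → Augmented
      grow (state f ls R C) (acc rec) with y , adm ← admissible-exists C with settle f ls y R C adm
      ... | inj₁ done     = done
      ... | inj₂ (s , s≤) = grow s (rec (≤-<-trans s≤ extended<))
        where
          extended< : val m (reverse (blockers f y ∷ digits f ls)) < val m (reverse (digits f ls))
          extended< = val-reverse-∷-< m (digits f ls) (blockers f y) (digits-length C)
                                      (s≤s (s≤s (count-≤ (blocks f y))))

      augment : ∀ f → RainbowOn A f → Augmented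
      augment f R = grow (state f [] R []) (<-wellFounded _)

    edgeOfColour : Fin c → Fin m
    edgeOfColour i = proj₁ (count-<-witness (λ j → isYes (χ j ≟ i)) (const false) nonempty)
      where
        nonempty : countFin {m} (const false) < classSize χ i
        nonempty = subst (_< classSize χ i) (sym (count-false {m} (const false) (λ _ → refl)))
                         (≤-trans 1≤4q (4q≤class i))

    rainbowBelow : ∀ k → k ≤ c → Σ (Fin c → Fin m) (RainbowOn (coloursBelow k))
    rainbowBelow zero    _   = edgeOfColour , record { coloured = λ i () ; disjoint = λ i j () }
    rainbowBelow (suc k) k<c with f , R ← rainbowBelow k (<⇒≤ k<c) =
      Product.map₂ (rainbow-⊆ below⊆) (Step.augment f R)
      where
        t : Fin c
        t = fromℕ< k<c

        t-new : coloursBelow k t ≡ false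
        t-new = isYes-false (toℕ t <? k) (<-irrefl (toℕ-fromℕ< k<c))

        module Step = Augmentation (coloursBelow k) t t-new

        below⊆ : ∀ i → coloursBelow (suc k) i ≡ true → Step.A⁺ i ≡ true
        below⊆ i e with m<1+n⇒m<n∨m≡n (isYes-true⁻¹ (toℕ i <? suc k) e)
        ... | inj₁ i<k = cong (_∨ isYes (i ≟ t)) (isYes-true (toℕ i <? k) i<k)
        ... | inj₂ i≡k = trans (cong (coloursBelow k i ∨_) (isYes-true (i ≟ t) i≡t)) (∨-zeroʳ _)
          where
            i≡t : i ≡ t
            i≡t = toℕ-injective (trans i≡k (sym (toℕ-fromℕ< k<c)))

AtLeast4eq⇒4q≤ : ∀ {q N} → AtLeast4eq q N → 4 * q ≤ N
AtLeast4eq⇒4q≤ {q} {N} h = subst₂ _≤_ (*-identityʳ (4 * q)) (*-identityʳ N) (h 0)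

proposition3p5 : (q : ℕ) → 1 ≤ q → (n m c : ℕ) (E : Fin m → Edge n) →
    Loopless E → NoParallel E → (∀ v → deg E v ≤ q) →
    (χ : Fin m → Fin c) → (∀ i → AtLeast4eq q (classSize χ i)) →
    Σ (Fin c → Fin m) (λ f → (∀ i → χ (f i) ≡ i) ×
      (∀ i j → ¬ (i ≡ j) → Disjoint (E (f i)) (E (f j))))
proposition3p5 q 1≤q n m c E _ _ deg≤q χ large =
  f , (λ i → coloured R i (everyColour i)) ,
  (λ i j i≢j → ¬touches⇒Disjoint E (f i) (f j) (disjoint R i j (everyColour i) (everyColour j) i≢j))
  where
    open Rainbow E χ
    open RainbowOn

    everyColour : ∀ i → coloursBelow c i ≡ true
    everyColour i = isYes-true (toℕ i <? c) (toℕ<n i)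

    rainbow : Σ (Fin c → Fin m) (RainbowOn (coloursBelow c))
    rainbow = Bounded.rainbowBelow 1≤q deg≤q (λ i → AtLeast4eq⇒4q≤ {q} (large i)) c ≤-refl

    f : Fin c → Fin m
    f = proj₁ rainbow

    R : RainbowOn (coloursBelow c) f
    R = proj₂ rainbow
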